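{- Let $G$ be a graph with $m(G)$ edges. Then $M_2^1(G)=\frac12M_1^2(L_1(G))-\frac12M_1^3(G)+2M_1^2(G)-2m(G)$, $EM_2(G)=\frac12M_1^2(L_2(G))-\frac12M_1^3(L_1(G))+2M_1^2(L_1(G))-2m(L_1(G))$, $\alpha_{1,2}(G)=\frac13M_1^3(L_1(G))-\frac13M_1^4(G)+2M_1^3(G)+4M_2^1(G)-4M_1^2(G)+\frac83m(G)$, $\Theta_2(G)=\frac12M_1^2(L_2(G))-\frac56M_1^3(L_1(G))+2M_1^2(L_1(G))-2m(L_1(G))-\frac16M_1^4(G)+\frac12M_1^3(G)+2M_2^1(G)-2M_1^2(G)+\frac43m(G)$.
   Context: $L_1(G)$ is the line graph of $G$ and $L_2(G)=L_1(L_1(G))$; $m(H)$ is the number of edges of $H$. $M_1^\alpha(H)=\sum_{v\in V(H)}\deg_H(v)^\alpha$; $M_2^1(G)=\sum_{uv\in E(G)}\deg(u)\deg(v)$; $\alpha_{1,2}(G)=\sum_{uv\in E(G)}[\deg(u)\deg(v)^2+\deg(u)^2\deg(v)]$. For an edge $e=uv$, $\deg(e)=\deg(u)+\deg(v)-2$, and $EM_2(G)=\sum\deg(e)\deg(f)$ over unordered pairs $\{e,f\}$ of distinct edges sharing a vertex. $\Theta_2(G)=\sum\deg(u)\deg(w)$ over all subgraphs of $G$ isomorphic to the path $P_3$ (each counted once), written $uvw$ with middle vertex $v$. -}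

module Defs where

open import Data.Nat using (ℕ; zero; suc; _+_; _*_; _∸_; _^_; _<ᵇ_)
open import Data.Bool using (Bool; true; false; _∧_; _∨_; not; if_then_else_)
open import Data.Fin using (Fin; toℕ; _≟_)
open import Data.List using (List; []; _∷_; [_]; _++_; length; lookup; concatMap; allFin)
open import Data.Product using (_×_; _,_; proj₁; proj₂)
open import Relation.Nullary using (does; yes; no)
open import Relation.Binary.PropositionalEquality using (_≡_; refl; cong₂)
open import Data.Empty using (⊥-elim)

record Graph : Set where
  field
    n     : ℕ
    adj   : Fin n → Fin n → Bool
    sym   : ∀ i j → adj i j ≡ adj j i
    irr   : ∀ i → adj i i ≡ false
open Graph public

sumFin : (k : ℕ) → (Fin k → ℕ) → ℕ
sumFin zero    f = 0
sumFin (suc k) f = f Fin.zero + sumFin k (λ i → f (Fin.suc i))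
  where import Data.Fin as Fin

b2n : Bool → ℕ
b2n true  = 1
b2n false = 0

-- Σ over unordered pairs {i , j} (i ≠ j, counted once as toℕ i < toℕ j)
-- satisfying the Boolean condition c, of f i j
sumPairs : (k : ℕ) → (Fin k → Fin k → Bool) → (Fin k → Fin k → ℕ) → ℕ
sumPairs k c f = sumFin k (λ i → sumFin k (λ j →
  if (toℕ i <ᵇ toℕ j) ∧ c i j then f i j else 0))

deg : (G : Graph) → Fin (n G) → ℕ
deg G v = sumFin (n G) (λ j → b2n (adj G v j))

edges : (G : Graph) → List (Fin (n G) × Fin (n G))
edges G = concatMap (λ i → concatMap (λ j →
  if (toℕ i <ᵇ toℕ j) ∧ adj G i j then [ (i , j) ] else []) (allFin (n G))) (allFin (n G))

m : Graph → ℕ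
m G = length (edges G)

edge : (G : Graph) → Fin (m G) → Fin (n G) × Fin (n G)
edge G e = lookup (edges G) e

eqb : ∀ {k} → Fin k → Fin k → Bool
eqb x y = does (x ≟ y)

share : ∀ {k} → Fin k × Fin k → Fin k × Fin k → Bool
share (a , b) (c , d) = eqb a c ∨ eqb a d ∨ eqb b c ∨ eqb b d

private
  eqb-sym : ∀ {k} (x y : Fin k) → eqb x y ≡ eqb y x
  eqb-sym x y with x ≟ y | y ≟ x
  ... | yes _ | yes _ = refl
  ... | no _  | no _  = refl
  ... | yes p | no q  = ⊥-elim (q (Relation.Binary.PropositionalEquality.sym p))
  ... | no q  | yes p = ⊥-elim (q (Relation.Binary.PropositionalEquality.sym p))

  eqb-refl : ∀ {k} (x : Fin k) → eqb x x ≡ true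
  eqb-refl x with x ≟ x
  ... | yes _ = refl
  ... | no q  = ⊥-elim (q refl)

  swap∨ : ∀ p q r s → (p ∨ q ∨ r ∨ s) ≡ (p ∨ r ∨ q ∨ s)
  swap∨ true  q r s = refl
  swap∨ false true  true  s = refl
  swap∨ false true  false s = refl
  swap∨ false false true  s = refl
  swap∨ false false false s = refl

  share-sym : ∀ {k} (e f : Fin k × Fin k) → share e f ≡ share f e
  share-sym (a , b) (c , d)
    rewrite eqb-sym a c | eqb-sym a d | eqb-sym b c | eqb-sym b d
    = swap∨ (eqb c a) (eqb d a) (eqb c b) (eqb d b)

  lineAdj : (G : Graph) → Fin (m G) → Fin (m G) → Bool
  lineAdj G k l = not (eqb k l) ∧ share (edge G k) (edge G l)

  lineAdj-sym : (G : Graph) → ∀ k l → lineAdj G k l ≡ lineAdj G l k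
  lineAdj-sym G k l = cong₂ (λ x y → not x ∧ y) (eqb-sym k l) (share-sym (edge G k) (edge G l))

  lineAdj-irr : (G : Graph) → ∀ k → lineAdj G k k ≡ false
  lineAdj-irr G k rewrite eqb-refl k = refl

L₁ : Graph → Graph
L₁ G = record { n = m G ; adj = lineAdj G ; sym = lineAdj-sym G ; irr = lineAdj-irr G }

L₂ : Graph → Graph
L₂ G = L₁ (L₁ G)

M₁ : ℕ → Graph → ℕ
M₁ α H = sumFin (n H) (λ v → deg H v ^ α)

M₂¹ : Graph → ℕ
M₂¹ G = sumPairs (n G) (adj G) (λ u v → deg G u * deg G v)

α₁₂ : Graph → ℕ
α₁₂ G = sumPairs (n G) (adj G)
  (λ u v → deg G u * deg G v ^ 2 + deg G u ^ 2 * deg G v)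

degE : (G : Graph) → Fin (m G) → ℕ
degE G e = deg G (proj₁ (edge G e)) + deg G (proj₂ (edge G e)) ∸ 2

EM₂ : Graph → ℕ
EM₂ G = sumPairs (m G) (λ e f → share (edge G e) (edge G f))
  (λ e f → degE G e * degE G f)

-- Θ₂(G) = Σ over P₃-subgraphs uvw (middle v, unordered ends {u , w}) of deg u deg w
Θ₂ : Graph → ℕ
Θ₂ G = sumFin (n G) (λ v → sumPairs (n G) (λ u w → adj G u v ∧ adj G w v)
  (λ u w → deg G u * deg G w))

-- For an edge e = uv of G, the degree of e in L₁(G) is d(u) + d(v) − 2: the edges meeting e are those
-- at u and those at v, with e itself counted twice.  Hence Σ_e deg_{L₁}(e)^k is a sum over the edges of G
-- of a polynomial in d(u) + d(v), and sums over edges of (symmetrised) products of vertex functions are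
-- degree-weighted vertex sums; this gives M₁²(L₁ G) and M₁³(L₁ G) in terms of M₁ᵏ(G), M₂¹(G), α₁₂(G), m(G).
-- Since deg(e) in EM₂ is the degree of e in L₁(G), EM₂(G) = M₂¹(L₁ G), and the first formula for L₁(G)
-- gives the second.  For Θ₂, 2 M₂¹(L₁ G) = Σ_e deg(e) Σ_{f ∼ e} deg(f), the inner sum is computed by the
-- same inclusion–exclusion, and with S(v) = Σ_{w ∼ v} d(w) one has Σ_v S(v)² = 2 Θ₂(G) + M₁³(G).
-- All identities are proved in ℕ with the subtracted terms moved across, and solved in ℚ at the end.

module Submission where

open import Defs hiding (sym)
open import Data.Product using (_×_)
open import Data.Nat using (ℕ)
open import Relation.Binary.PropositionalEquality using (_≡_)

module DegreeSums where
  open import Data.Nat using (zero; suc; _+_; _*_; _^_; _∸_; _<ᵇ_; _<_; _≤_; s≤s)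
  open import Data.Nat.Properties
    using (+-identityʳ; *-identityˡ; *-identityʳ; *-zeroʳ; *-suc; *-comm; *-distribˡ-+; *-distribʳ-+;
           <-cmp; <⇒≤; ≤-refl; ^-identityʳ; +-comm; +-cancelʳ-≡; m+n∸n≡m;
           +-commutativeSemigroup; *-commutativeSemigroup)
  open import Algebra.Properties.CommutativeSemigroup +-commutativeSemigroup using () renaming (interchange to +-interchange)
  open import Algebra.Properties.CommutativeSemigroup *-commutativeSemigroup
    using () renaming (interchange to *-interchange; x∙yz≈y∙xz to *-left-comm)
  open import Data.Nat.Tactic.RingSolver using (solve-∀)
  open import Data.Nat.Solver using (module +-*-Solver)
  open +-*-Solver using (solve; _:+_; _:*_; _:^_; _:=_; con)
  open import Data.Bool using (Bool; true; false; _∧_; not; if_then_else_)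
  open import Data.Bool.Properties using (∧-comm; ∧-idem)
  open import Data.Fin as Fin using (Fin; toℕ; _≟_)
  open import Data.Fin.Properties using (toℕ-injective)
  open import Data.Product using (_,_; proj₁; proj₂)
  open import Data.List using (List; []; _∷_; [_]; _++_; length; lookup; map; concatMap; tabulate; allFin)
  open import Data.List.Properties using (map-++)
  open import Data.List.Relation.Unary.All as All using (All; []; _∷_)
  open import Data.List.Relation.Unary.All.Properties using (concat⁺; map⁺; tabulate⁺)
  open import Data.List.Membership.Propositional.Properties using (∈-lookup)
  open import Data.Nat.ListAction using (sum)
  open import Data.Nat.ListAction.Properties using (sum-++)
  open import Function using (_∘_; id)
  open import Relation.Binary.Definitions using (tri<; tri≈; tri>)
  open import Relation.Binary.PropositionalEquality using (refl; sym; trans; cong; cong₂; module ≡-Reasoning)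
  open import Relation.Nullary using (¬_; yes; no)
  open import Data.Empty using (⊥-elim)
  open import Relation.Nullary.Decidable using (dec-true; dec-false)
  open ≡-Reasoning

  -- Finite sums

  m^2≡m*m : ∀ m → m ^ 2 ≡ m * m
  m^2≡m*m m = cong (m *_) (^-identityʳ m)

  sumFin-cong : ∀ k {f g : Fin k → ℕ} → (∀ i → f i ≡ g i) → sumFin k f ≡ sumFin k g
  sumFin-cong zero    f≗g = refl
  sumFin-cong (suc k) f≗g = cong₂ _+_ (f≗g Fin.zero) (sumFin-cong k (f≗g ∘ Fin.suc))

  sumFin-const : ∀ k c → sumFin k (λ _ → c) ≡ c * k
  sumFin-const zero    c = sym (*-zeroʳ c)
  sumFin-const (suc k) c = trans (cong (c +_) (sumFin-const k c)) (sym (*-suc c k))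

  sumFin-1 : ∀ k → sumFin k (λ _ → 1) ≡ k
  sumFin-1 k = trans (sumFin-const k 1) (*-identityˡ k)

  sumFin-+ : ∀ k (f g : Fin k → ℕ) → sumFin k (λ i → f i + g i) ≡ sumFin k f + sumFin k g
  sumFin-+ zero    f g = refl
  sumFin-+ (suc k) f g = trans (cong (f Fin.zero + g Fin.zero +_) (sumFin-+ k (f ∘ Fin.suc) (g ∘ Fin.suc)))
                               (+-interchange (f Fin.zero) (g Fin.zero) _ _)

  sumFin-*ˡ : ∀ k c (f : Fin k → ℕ) → sumFin k (λ i → c * f i) ≡ c * sumFin k f
  sumFin-*ˡ zero    c f = sym (*-zeroʳ c)
  sumFin-*ˡ (suc k) c f = trans (cong (c * f Fin.zero +_) (sumFin-*ˡ k c (f ∘ Fin.suc)))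
                                (sym (*-distribˡ-+ c _ _))

  sumFin-*ʳ : ∀ k c (f : Fin k → ℕ) → sumFin k (λ i → f i * c) ≡ sumFin k f * c
  sumFin-*ʳ k c f = trans (sumFin-cong k (λ i → *-comm (f i) c)) (trans (sumFin-*ˡ k c f) (*-comm c _))

  sumFin-+-*ˡ : ∀ k (f g : Fin k → ℕ) c → sumFin k (λ i → f i + c * g i) ≡ sumFin k f + c * sumFin k g
  sumFin-+-*ˡ k f g c = trans (sumFin-+ k f _) (cong (sumFin k f +_) (sumFin-*ˡ k c g))

  sumFin-comm : ∀ k l (f : Fin k → Fin l → ℕ) →
                sumFin k (λ i → sumFin l (f i)) ≡ sumFin l (λ j → sumFin k (λ i → f i j))
  sumFin-comm zero    l f = sym (sumFin-const l 0)
  sumFin-comm (suc k) l f = trans (cong (sumFin l (f Fin.zero) +_) (sumFin-comm k l (f ∘ Fin.suc)))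
                                  (sym (sumFin-+ l _ _))

  sumFin-*-sumFin : ∀ k (f g : Fin k → ℕ) →
                    sumFin k (λ i → sumFin k (λ j → f i * g j)) ≡ sumFin k f * sumFin k g
  sumFin-*-sumFin k f g = trans (sumFin-cong k (λ i → sumFin-*ˡ k (f i) g)) (sumFin-*ʳ k (sumFin k g) f)

  δ : ∀ {k} → Fin k → Fin k → ℕ
  δ i j = b2n (eqb i j)

  δ-refl : ∀ {k} (i : Fin k) → δ i i ≡ 1
  δ-refl i = cong b2n (dec-true (i ≟ i) refl)

  δ-≢ : ∀ {k} {i j : Fin k} → ¬ i ≡ j → δ i j ≡ 0
  δ-≢ {i = i} {j} i≢j = cong b2n (dec-false (i ≟ j) i≢j)

  sumFin-δ : ∀ k (i : Fin k) (f : Fin k → ℕ) → sumFin k (λ j → δ i j * f j) ≡ f i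
  sumFin-δ (suc k) Fin.zero    f = trans (cong₂ _+_ (*-identityˡ _) (sumFin-const k 0)) (+-identityʳ _)
  sumFin-δ (suc k) (Fin.suc i) f = sumFin-δ k i (f ∘ Fin.suc)

  b2n-* : ∀ b x → b2n b * x ≡ (if b then x else 0)
  b2n-* true  x = +-identityʳ x
  b2n-* false x = refl

  b2n-∧ : ∀ x y → b2n (x ∧ y) ≡ b2n x * b2n y
  b2n-∧ true  y = sym (+-identityʳ (b2n y))
  b2n-∧ false y = refl

  <ᵇ-true : ∀ {a b} → a < b → (a <ᵇ b) ≡ true
  <ᵇ-true {zero}  (s≤s _)   = refl
  <ᵇ-true {suc a} (s≤s a<b) = <ᵇ-true a<b

  <ᵇ-false : ∀ {a b} → b ≤ a → (a <ᵇ b) ≡ false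
  <ᵇ-false {b = zero}          _         = refl
  <ᵇ-false {suc a} {suc b} (s≤s b≤a) = <ᵇ-false b≤a

  module _ (k : ℕ) (c : Fin k → Fin k → Bool) (c-sym : ∀ i j → c i j ≡ c j i) where
    private
      above below : (Fin k → Fin k → ℕ) → Fin k → Fin k → ℕ
      above f i j = if (toℕ i <ᵇ toℕ j) ∧ c i j then f i j else 0
      below f i j = if (toℕ j <ᵇ toℕ i) ∧ c j i then f i j else 0

      split-pointwise : ∀ f i j → b2n (c i j) * f i j ≡ above f i j + below f i j + δ i j * (b2n (c i j) * f i j)
      split-pointwise f i j with <-cmp (toℕ i) (toℕ j)
      ... | tri< i<j i≢j _ rewrite <ᵇ-true i<j | <ᵇ-false (<⇒≤ i<j) | δ-≢ (i≢j ∘ cong toℕ)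
        = trans (b2n-* (c i j) (f i j)) (sym (trans (+-identityʳ _) (+-identityʳ _)))
      ... | tri> _ i≢j j<i rewrite <ᵇ-true j<i | <ᵇ-false (<⇒≤ j<i) | δ-≢ (i≢j ∘ cong toℕ) | c-sym j i
        = trans (b2n-* (c i j) (f i j)) (sym (+-identityʳ _))
      ... | tri≈ _ i≡j _ with toℕ-injective i≡j
      ...   | refl rewrite <ᵇ-false (≤-refl {toℕ i}) | δ-refl i = sym (+-identityʳ _)

    sumFin²-split : ∀ f → sumFin k (λ i → sumFin k (λ j → b2n (c i j) * f i j))
                    ≡ sumPairs k c f + sumPairs k c (λ i j → f j i) + sumFin k (λ i → b2n (c i i) * f i i)
    sumFin²-split f = begin
      sumFin k (λ i → sumFin k (λ j → b2n (c i j) * f i j))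
        ≡⟨ sumFin-cong k (λ i → trans (sumFin-cong k (split-pointwise f i))
             (trans (sumFin-+ k _ _) (cong₂ _+_ (sumFin-+ k _ _) (sumFin-δ k i _)))) ⟩
      sumFin k (λ i → sumFin k (above f i) + sumFin k (below f i) + b2n (c i i) * f i i)
        ≡⟨ trans (sumFin-+ k _ _) (cong (_+ diagonal) (sumFin-+ k _ _)) ⟩
      sumPairs k c f + sumFin k (λ i → sumFin k (below f i)) + sumFin k (λ i → b2n (c i i) * f i i)
        ≡⟨ cong (λ z → sumPairs k c f + z + diagonal) (sumFin-comm k k (below f)) ⟩
      sumPairs k c f + sumPairs k c (λ i j → f j i) + sumFin k (λ i → b2n (c i i) * f i i) ∎
      where diagonal : ℕ
            diagonal = sumFin k (λ i → b2n (c i i) * f i i)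

  -- Sums over edges, arcs and neighbourhoods

  share-δ : ∀ {k} {a b c e : Fin k} → ¬ a ≡ b → ¬ c ≡ e →
            b2n (share (a , b) (c , e)) + (δ a c * δ b e + δ a e * δ b c) ≡ (δ a c + δ a e) + (δ b c + δ b e)
  share-δ {a = a} {b} {c} {e} a≢b c≢e with a ≟ c | a ≟ e | b ≟ c | b ≟ e
  ... | yes a≡c | yes a≡e | _       | _       = ⊥-elim (c≢e (trans (sym a≡c) a≡e))
  ... | yes a≡c | _       | yes b≡c | _       = ⊥-elim (a≢b (trans a≡c (sym b≡c)))
  ... | _       | yes a≡e | _       | yes b≡e = ⊥-elim (a≢b (trans a≡e (sym b≡e)))
  ... | _       | _       | yes b≡c | yes b≡e = ⊥-elim (c≢e (trans (sym b≡c) b≡e))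
  ... | yes _   | no _    | no _    | yes _   = refl
  ... | no _    | yes _   | yes _   | no _    = refl
  ... | yes _   | no _    | no _    | no _    = refl
  ... | no _    | yes _   | no _    | no _    = refl
  ... | no _    | no _    | yes _   | no _    = refl
  ... | no _    | no _    | no _    | yes _   = refl
  ... | no _    | no _    | no _    | no _    = refl

  share-refl : ∀ {k} (a b : Fin k) → share (a , b) (a , b) ≡ true
  share-refl a b rewrite dec-true (a ≟ a) refl = refl

  sumFin-off-diagonal : ∀ K (k : Fin K) (s : Fin K → Bool) (g : Fin K → ℕ) → s k ≡ true →
    sumFin K (λ l → b2n (not (eqb k l) ∧ s l) * g l) + g k ≡ sumFin K (λ l → b2n (s l) * g l)
  sumFin-off-diagonal K k s g sk = begin
    sumFin K off-diagonal + g k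
      ≡⟨ cong (sumFin K off-diagonal +_) (sym diagonal) ⟩
    sumFin K off-diagonal + sumFin K (λ l → δ k l * (b2n (s l) * g l))
      ≡⟨ sym (sumFin-+ K _ _) ⟩
    sumFin K (λ l → off-diagonal l + δ k l * (b2n (s l) * g l))
      ≡⟨ sumFin-cong K pointwise ⟩
    sumFin K (λ l → b2n (s l) * g l) ∎
    where
    off-diagonal : Fin K → ℕ
    off-diagonal l = b2n (not (eqb k l) ∧ s l) * g l
    diagonal : sumFin K (λ l → δ k l * (b2n (s l) * g l)) ≡ g k
    diagonal = trans (sumFin-δ K k _) (trans (cong (λ b → b2n b * g k) sk) (+-identityʳ (g k)))
    pointwise : ∀ l → b2n (not (eqb k l) ∧ s l) * g l + δ k l * (b2n (s l) * g l) ≡ b2n (s l) * g l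
    pointwise l with k ≟ l
    ... | yes _ = +-identityʳ _
    ... | no _  = +-identityʳ _

  sum-map-lookup : ∀ {A : Set} (g : A → ℕ) (xs : List A) → sumFin (length xs) (g ∘ lookup xs) ≡ sum (map g xs)
  sum-map-lookup g []       = refl
  sum-map-lookup g (x ∷ xs) = cong (g x +_) (sum-map-lookup g xs)

  sum-map-concatMap : ∀ {A B : Set} (g : B → ℕ) (f : A → List B) (xs : List A) →
                      sum (map g (concatMap f xs)) ≡ sum (map (sum ∘ map g ∘ f) xs)
  sum-map-concatMap g f []       = refl
  sum-map-concatMap g f (x ∷ xs) = begin
    sum (map g (f x ++ concatMap f xs))               ≡⟨ cong sum (map-++ g (f x) _) ⟩
    sum (map g (f x) ++ map g (concatMap f xs))       ≡⟨ sum-++ (map g (f x)) _ ⟩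
    sum (map g (f x)) + sum (map g (concatMap f xs))  ≡⟨ cong (_ +_) (sum-map-concatMap g f xs) ⟩
    sum (map (sum ∘ map g ∘ f) (x ∷ xs))              ∎

  sum-map-tabulate : ∀ {A : Set} (g : A → ℕ) k (f : Fin k → A) → sum (map g (tabulate f)) ≡ sumFin k (g ∘ f)
  sum-map-tabulate g zero    f = refl
  sum-map-tabulate g (suc k) f = cong (g (f Fin.zero) +_) (sum-map-tabulate g k (f ∘ Fin.suc))

  sum-map-if : ∀ {A : Set} (g : A → ℕ) b (x : A) → sum (map g (if b then [ x ] else [])) ≡ (if b then g x else 0)
  sum-map-if g true  x = +-identityʳ (g x)
  sum-map-if g false x = refl

  module _ (G : Graph) where

    end₁ end₂ : Fin (m G) → Fin (n G)
    end₁ e = proj₁ (edge G e)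
    end₂ e = proj₂ (edge G e)

    sumEdges : (Fin (n G) → Fin (n G) → ℕ) → ℕ
    sumEdges F = sumFin (m G) (λ e → F (end₁ e) (end₂ e))

    sumArcs : (Fin (n G) → Fin (n G) → ℕ) → ℕ
    sumArcs F = sumFin (n G) (λ i → sumFin (n G) (λ j → b2n (adj G i j) * F i j))

    nbrSum : (Fin (n G) → ℕ) → Fin (n G) → ℕ
    nbrSum h v = sumFin (n G) (λ w → b2n (adj G v w) * h w)

    private
      candidate : Fin (n G) → Fin (n G) → List (Fin (n G) × Fin (n G))
      candidate i j = if (toℕ i <ᵇ toℕ j) ∧ adj G i j then [ (i , j) ] else []

    sumEdges≡sumPairs : ∀ (F : Fin (n G) → Fin (n G) → ℕ) → sumEdges F ≡ sumPairs (n G) (adj G) F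
    sumEdges≡sumPairs F = begin
      sumEdges F                                    ≡⟨ sum-map-lookup F′ (edges G) ⟩
      sum (map F′ (edges G))                        ≡⟨ sum-map-concatMap F′ _ (allFin (n G)) ⟩
      sum (map (λ i → sum (map F′ (concatMap (candidate i) (allFin (n G))))) (allFin (n G)))
        ≡⟨ sum-map-tabulate _ (n G) id ⟩
      sumFin (n G) (λ i → sum (map F′ (concatMap (candidate i) (allFin (n G)))))
        ≡⟨ sumFin-cong (n G) (λ i → trans (sum-map-concatMap F′ (candidate i) (allFin (n G)))
             (trans (sum-map-tabulate _ (n G) id) (sumFin-cong (n G) (λ j → sum-map-if F′ _ (i , j))))) ⟩
      sumPairs (n G) (adj G) F                      ∎
      where
      F′ : Fin (n G) × Fin (n G) → ℕ
      F′ (i , j) = F i j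

    edge-adj : ∀ e → adj G (end₁ e) (end₂ e) ≡ true
    edge-adj e = All.lookup candidates-adjacent (∈-lookup e)
      where
      Adjacent : Fin (n G) × Fin (n G) → Set
      Adjacent (i , j) = adj G i j ≡ true
      candidate-adjacent : ∀ i j → All Adjacent (candidate i j)
      candidate-adjacent i j with toℕ i <ᵇ toℕ j | adj G i j in ij
      ... | true  | true  = ij ∷ []
      ... | true  | false = []
      ... | false | _     = []
      candidates-adjacent : All Adjacent (edges G)
      candidates-adjacent = concat⁺ (map⁺ (tabulate⁺ λ i → concat⁺ (map⁺ (tabulate⁺ (candidate-adjacent i)))))

    sumArcs≡sumEdges : ∀ (F : Fin (n G) → Fin (n G) → ℕ) → sumArcs F ≡ sumEdges (λ i j → F i j + F j i)
    sumArcs≡sumEdges F = begin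
      sumArcs F
        ≡⟨ sumFin²-split (n G) (adj G) (Graph.sym G) F ⟩
      sumPairs (n G) (adj G) F + sumPairs (n G) (adj G) (λ i j → F j i) + sumFin (n G) (λ i → b2n (adj G i i) * F i i)
        ≡⟨ cong₂ _+_ (cong₂ _+_ (sym (sumEdges≡sumPairs F)) (sym (sumEdges≡sumPairs _)))
                     (trans (sumFin-cong (n G) (λ i → cong (λ b → b2n b * F i i) (Graph.irr G i))) (sumFin-const (n G) 0)) ⟩
      sumEdges F + sumEdges (λ i j → F j i) + 0
        ≡⟨ trans (+-identityʳ _) (sym (sumFin-+ (m G) _ _)) ⟩
      sumEdges (λ i j → F i j + F j i) ∎

    sumArcs-separable : ∀ (g h : Fin (n G) → ℕ) → sumArcs (λ i j → g i * h j) ≡ sumFin (n G) (λ i → g i * nbrSum h i)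
    sumArcs-separable g h = sumFin-cong (n G) (λ i →
      trans (sumFin-cong (n G) (λ j → *-left-comm (b2n (adj G i j)) (g i) (h j))) (sumFin-*ˡ (n G) (g i) _))

    nbrSum-self-adjoint : ∀ (g h : Fin (n G) → ℕ) → sumFin (n G) (λ v → g v * nbrSum h v) ≡ sumFin (n G) (λ v → h v * nbrSum g v)
    nbrSum-self-adjoint g h = begin
      sumFin (n G) (λ v → g v * nbrSum h v)  ≡⟨ sym (sumArcs-separable g h) ⟩
      sumArcs (λ i j → g i * h j)             ≡⟨ sumFin-comm (n G) (n G) _ ⟩
      sumFin (n G) (λ j → sumFin (n G) (λ i → b2n (adj G i j) * (g i * h j)))
        ≡⟨ sumFin-cong (n G) (λ j → sumFin-cong (n G) (λ i →
             cong₂ _*_ (cong b2n (Graph.sym G i j)) (*-comm (g i) (h j)))) ⟩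
      sumArcs (λ i j → h i * g j)             ≡⟨ sumArcs-separable h g ⟩
      sumFin (n G) (λ v → h v * nbrSum g v)  ∎

    sumEdges-symmetrised : ∀ (g h : Fin (n G) → ℕ) → sumEdges (λ i j → g i * h j + g j * h i) ≡ sumFin (n G) (λ v → g v * nbrSum h v)
    sumEdges-symmetrised g h = trans (sym (sumArcs≡sumEdges _)) (sumArcs-separable g h)

    sumEdges-endpoints : ∀ (h : Fin (n G) → ℕ) → sumEdges (λ i j → h i + h j) ≡ sumFin (n G) (λ v → deg G v * h v)
    sumEdges-endpoints h = trans (sym (sumArcs≡sumEdges (λ i j → h i)))
                                 (sumFin-cong (n G) (λ i → sumFin-*ʳ (n G) (h i) _))

    nbrSum-+ : ∀ (f g : Fin (n G) → ℕ) v → nbrSum (λ w → f w + g w) v ≡ nbrSum f v + nbrSum g v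
    nbrSum-+ f g v = trans (sumFin-cong (n G) (λ w → *-distribˡ-+ (b2n (adj G v w)) (f w) (g w))) (sumFin-+ (n G) _ _)

    nbrSum-cong : ∀ {f g : Fin (n G) → ℕ} → (∀ w → f w ≡ g w) → ∀ v → nbrSum f v ≡ nbrSum g v
    nbrSum-cong f≗g v = sumFin-cong (n G) (λ w → cong (b2n (adj G v w) *_) (f≗g w))

    nbrSum-const : ∀ c v → nbrSum (λ _ → c) v ≡ deg G v * c
    nbrSum-const c v = sumFin-*ʳ (n G) c _

    nbrSum-1 : ∀ v → nbrSum (λ _ → 1) v ≡ deg G v
    nbrSum-1 v = trans (nbrSum-const 1 v) (*-identityʳ (deg G v))

    sumArcs-δ : ∀ a (F : Fin (n G) → Fin (n G) → ℕ) → sumArcs (λ c e → δ a c * F c e) ≡ nbrSum (F a) a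
    sumArcs-δ a F = trans (sumFin-cong (n G) (λ c → trans (sumFin-cong (n G) (λ e → *-left-comm (b2n (adj G c e)) (δ a c) (F c e)))
                                                          (sumFin-*ˡ (n G) (δ a c) _)))
                          (sumFin-δ (n G) a _)

    Symmetric : (Fin (n G) → Fin (n G) → ℕ) → Set
    Symmetric φ = ∀ i j → φ i j ≡ φ j i

    sumEdges-star : ∀ a φ → Symmetric φ → sumEdges (λ c e → (δ a c + δ a e) * φ c e) ≡ nbrSum (φ a) a
    sumEdges-star a φ φ-sym = begin
      sumEdges (λ c e → (δ a c + δ a e) * φ c e)
        ≡⟨ sumFin-cong (m G) (λ k → pointwise (end₁ k) (end₂ k)) ⟩
      sumEdges (λ c e → δ a c * φ c e + δ a e * φ e c)  ≡⟨ sym (sumArcs≡sumEdges _) ⟩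
      sumArcs (λ c e → δ a c * φ c e)                    ≡⟨ sumArcs-δ a φ ⟩
      nbrSum (φ a) a                                      ∎
      where
      pointwise : ∀ c e → (δ a c + δ a e) * φ c e ≡ δ a c * φ c e + δ a e * φ e c
      pointwise c e = trans (*-distribʳ-+ (φ c e) (δ a c) (δ a e)) (cong (λ x → δ a c * φ c e + δ a e * x) (φ-sym c e))

    sumEdges-single : ∀ a b φ → Symmetric φ → adj G a b ≡ true →
                      sumEdges (λ c e → (δ a c * δ b e + δ a e * δ b c) * φ c e) ≡ φ a b
    sumEdges-single a b φ φ-sym ab = begin
      sumEdges (λ c e → (δ a c * δ b e + δ a e * δ b c) * φ c e)
        ≡⟨ sumFin-cong (m G) (λ k → pointwise (end₁ k) (end₂ k)) ⟩
      sumEdges (λ c e → δ a c * (δ b e * φ c e) + δ a e * (δ b c * φ e c))  ≡⟨ sym (sumArcs≡sumEdges _) ⟩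
      sumArcs (λ c e → δ a c * (δ b e * φ c e))                              ≡⟨ sumArcs-δ a _ ⟩
      nbrSum (λ e → δ b e * φ a e) a
        ≡⟨ trans (sumFin-cong (n G) (λ e → *-left-comm (b2n (adj G a e)) (δ b e) (φ a e))) (sumFin-δ (n G) b _) ⟩
      b2n (adj G a b) * φ a b                                                ≡⟨ cong (λ x → b2n x * φ a b) ab ⟩
      1 * φ a b                                                              ≡⟨ *-identityˡ (φ a b) ⟩
      φ a b                                                                  ∎
      where
      reorder : ∀ p q r s x → (p * q + r * s) * x ≡ p * (q * x) + r * (s * x)
      reorder = solve-∀
      pointwise : ∀ c e → (δ a c * δ b e + δ a e * δ b c) * φ c e ≡ δ a c * (δ b e * φ c e) + δ a e * (δ b c * φ e c)
      pointwise c e = trans (reorder (δ a c) (δ b e) (δ a e) (δ b c) (φ c e))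
                            (cong (λ x → δ a c * (δ b e * φ c e) + δ a e * (δ b c * x)) (φ-sym c e))

    adj-irrefl : ∀ {i j} → adj G i j ≡ true → ¬ i ≡ j
    adj-irrefl {i} ij refl with trans (sym ij) (Graph.irr G i)
    ... | ()

    -- An edge meeting ab meets a or b, and ab itself meets both.
    sumEdges-share : ∀ {a b} φ → Symmetric φ → adj G a b ≡ true →
      sumEdges (λ c e → b2n (share (a , b) (c , e)) * φ c e) + φ a b ≡ nbrSum (φ a) a + nbrSum (φ b) b
    sumEdges-share {a} {b} φ φ-sym ab = begin
      sumEdges (λ c e → b2n (share (a , b) (c , e)) * φ c e) + φ a b
        ≡⟨ cong (sumEdges (λ c e → b2n (share (a , b) (c , e)) * φ c e) +_) (sym (sumEdges-single a b φ φ-sym ab)) ⟩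
      sumEdges (λ c e → b2n (share (a , b) (c , e)) * φ c e) + sumEdges (λ c e → (δ a c * δ b e + δ a e * δ b c) * φ c e)
        ≡⟨ sym (sumFin-+ (m G) _ _) ⟩
      sumEdges (λ c e → b2n (share (a , b) (c , e)) * φ c e + (δ a c * δ b e + δ a e * δ b c) * φ c e)
        ≡⟨ sumFin-cong (m G) (λ k → pointwise (adj-irrefl (edge-adj k))) ⟩
      sumEdges (λ c e → (δ a c + δ a e) * φ c e + (δ b c + δ b e) * φ c e)
        ≡⟨ sumFin-+ (m G) _ _ ⟩
      sumEdges (λ c e → (δ a c + δ a e) * φ c e) + sumEdges (λ c e → (δ b c + δ b e) * φ c e)
        ≡⟨ cong₂ _+_ (sumEdges-star a φ φ-sym) (sumEdges-star b φ φ-sym) ⟩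
      nbrSum (φ a) a + nbrSum (φ b) b ∎
      where
      pointwise : ∀ {c e} → ¬ c ≡ e →
        b2n (share (a , b) (c , e)) * φ c e + (δ a c * δ b e + δ a e * δ b c) * φ c e
          ≡ (δ a c + δ a e) * φ c e + (δ b c + δ b e) * φ c e
      pointwise {c} {e} c≢e = begin
        b2n (share (a , b) (c , e)) * φ c e + (δ a c * δ b e + δ a e * δ b c) * φ c e
          ≡⟨ sym (*-distribʳ-+ (φ c e) (b2n (share (a , b) (c , e))) (δ a c * δ b e + δ a e * δ b c)) ⟩
        (b2n (share (a , b) (c , e)) + (δ a c * δ b e + δ a e * δ b c)) * φ c e
          ≡⟨ cong (_* φ c e) (share-δ (adj-irrefl ab) c≢e) ⟩
        ((δ a c + δ a e) + (δ b c + δ b e)) * φ c e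
          ≡⟨ *-distribʳ-+ (φ c e) (δ a c + δ a e) (δ b c + δ b e) ⟩
        (δ a c + δ a e) * φ c e + (δ b c + δ b e) * φ c e ∎

  -- Degree sums

  module _ (G : Graph) where
    private
      d = deg G
      S = nbrSum G (deg G)

    sumEdges-M₂¹ : sumEdges G (λ i j → d i * d j) ≡ M₂¹ G
    sumEdges-M₂¹ = sumEdges≡sumPairs G _

    sumEdges-α₁₂ : sumEdges G (λ i j → d i * d j ^ 2 + d i ^ 2 * d j) ≡ α₁₂ G
    sumEdges-α₁₂ = sumEdges≡sumPairs G _

    sumFin-deg-nbrSum-deg : sumFin (n G) (λ v → d v * S v) ≡ 2 * M₂¹ G
    sumFin-deg-nbrSum-deg = begin
      sumFin (n G) (λ v → d v * S v)                ≡⟨ sym (sumEdges-symmetrised G d d) ⟩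
      sumEdges G (λ i j → d i * d j + d j * d i)    ≡⟨ sumFin-cong (m G) (λ k → double (d (end₁ G k)) (d (end₂ G k))) ⟩
      sumEdges G (λ i j → 2 * (d i * d j))          ≡⟨ sumFin-*ˡ (m G) 2 _ ⟩
      2 * sumEdges G (λ i j → d i * d j)            ≡⟨ cong (2 *_) sumEdges-M₂¹ ⟩
      2 * M₂¹ G                                     ∎
      where double : ∀ x y → x * y + y * x ≡ 2 * (x * y)
            double = solve-∀

    sumFin-deg²-nbrSum-deg : sumFin (n G) (λ v → d v ^ 2 * S v) ≡ α₁₂ G
    sumFin-deg²-nbrSum-deg = begin
      sumFin (n G) (λ v → d v ^ 2 * S v)                  ≡⟨ sym (sumEdges-symmetrised G (λ v → d v ^ 2) d) ⟩
      sumEdges G (λ i j → d i ^ 2 * d j + d j ^ 2 * d i)  ≡⟨ sumFin-cong (m G) (λ k → swap (d (end₁ G k)) (d (end₂ G k))) ⟩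
      sumEdges G (λ i j → d i * d j ^ 2 + d i ^ 2 * d j)  ≡⟨ sumEdges-α₁₂ ⟩
      α₁₂ G                                               ∎
      where swap : ∀ x y → x ^ 2 * y + y ^ 2 * x ≡ x * y ^ 2 + x ^ 2 * y
            swap = solve 2 (λ x y → x :^ 2 :* y :+ y :^ 2 :* x := x :* y :^ 2 :+ x :^ 2 :* y) refl

    nbrSum-deg-square : ∀ v → S v * S v ≡
      2 * sumPairs (n G) (λ u w → adj G u v ∧ adj G w v) (λ u w → d u * d w) + sumFin (n G) (λ u → b2n (adj G u v) * d u ^ 2)
    nbrSum-deg-square v = begin
      S v * S v
        ≡⟨ sym (sumFin-*-sumFin (n G) _ _) ⟩
      sumFin (n G) (λ u → sumFin (n G) (λ w → (b2n (adj G v u) * d u) * (b2n (adj G v w) * d w)))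
        ≡⟨ sumFin-cong (n G) (λ u → sumFin-cong (n G) (λ w → pointwise u w)) ⟩
      sumFin (n G) (λ u → sumFin (n G) (λ w → b2n (common u w) * (d u * d w)))
        ≡⟨ sumFin²-split (n G) common (λ u w → ∧-comm (adj G u v) (adj G w v)) _ ⟩
      sumPairs (n G) common (λ u w → d u * d w) + sumPairs (n G) common (λ u w → d w * d u)
        + sumFin (n G) (λ u → b2n (common u u) * (d u * d u))
        ≡⟨ cong₂ _+_ (cong (sumPairs (n G) common (λ u w → d u * d w) +_) transposed) (sumFin-cong (n G) diagonal) ⟩
      sumPairs (n G) common (λ u w → d u * d w) + sumPairs (n G) common (λ u w → d u * d w)
        + sumFin (n G) (λ u → b2n (adj G u v) * d u ^ 2)
        ≡⟨ cong (_+ sumFin (n G) (λ u → b2n (adj G u v) * d u ^ 2)) (sym (double (sumPairs (n G) common (λ u w → d u * d w)))) ⟩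
      2 * sumPairs (n G) common (λ u w → d u * d w) + sumFin (n G) (λ u → b2n (adj G u v) * d u ^ 2) ∎
      where
      common : Fin (n G) → Fin (n G) → Bool
      common u w = adj G u v ∧ adj G w v
      pointwise : ∀ u w → (b2n (adj G v u) * d u) * (b2n (adj G v w) * d w) ≡ b2n (common u w) * (d u * d w)
      pointwise u w rewrite b2n-∧ (adj G u v) (adj G w v) | Graph.sym G v u | Graph.sym G v w =
        *-interchange (b2n (adj G u v)) (d u) (b2n (adj G w v)) (d w)
      transposed : sumPairs (n G) common (λ u w → d w * d u) ≡ sumPairs (n G) common (λ u w → d u * d w)
      transposed = sumFin-cong (n G) (λ u → sumFin-cong (n G) (λ w → cong (λ x → if (toℕ u <ᵇ toℕ w) ∧ common u w then x else 0) (*-comm (d w) (d u))))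
      diagonal : ∀ u → b2n (common u u) * (d u * d u) ≡ b2n (adj G u v) * d u ^ 2
      diagonal u = cong₂ _*_ (cong b2n (∧-idem (adj G u v))) (sym (m^2≡m*m (d u)))
      double : ∀ x → 2 * x ≡ x + x
      double = solve-∀

    sumFin-nbrSum-deg² : sumFin (n G) (λ v → S v * S v) ≡ 2 * Θ₂ G + M₁ 3 G
    sumFin-nbrSum-deg² = begin
      sumFin (n G) (λ v → S v * S v)
        ≡⟨ trans (sumFin-cong (n G) nbrSum-deg-square) (sumFin-+ (n G) _ _) ⟩
      sumFin (n G) (λ v → 2 * sumPairs (n G) (λ u w → adj G u v ∧ adj G w v) (λ u w → d u * d w))
        + sumFin (n G) (λ v → sumFin (n G) (λ u → b2n (adj G u v) * d u ^ 2))
        ≡⟨ cong₂ _+_ (sumFin-*ˡ (n G) 2 _) (sumFin-comm (n G) (n G) _) ⟩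
      2 * Θ₂ G + sumFin (n G) (λ u → sumFin (n G) (λ v → b2n (adj G u v) * d u ^ 2))
        ≡⟨ cong (2 * Θ₂ G +_) (sumFin-cong (n G) (λ u → sumFin-*ʳ (n G) (d u ^ 2) _)) ⟩
      2 * Θ₂ G + M₁ 3 G ∎

    -- the sum of deg f + 2 over the edges f at v
    ψ : Fin (n G) → ℕ
    ψ v = d v ^ 2 + S v

    nbrSum-deg+deg : ∀ v → nbrSum G (λ w → d v + d w) v ≡ ψ v
    nbrSum-deg+deg v = trans (nbrSum-+ G (λ _ → d v) d v) (cong (_+ S v) (trans (nbrSum-const G (d v) v) (sym (m^2≡m*m (d v)))))

    sumEdges-deg-sum : sumEdges G (λ i j → d i + d j) ≡ M₁ 2 G
    sumEdges-deg-sum = trans (sumEdges-endpoints G d) (sumFin-cong (n G) (λ v → cong (d v *_) (sym (^-identityʳ (d v)))))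

    sumEdges-deg-sum-* : ∀ (g : Fin (n G) → ℕ) → sumEdges G (λ i j → (d i + d j) * (g i + g j))
                         ≡ sumFin (n G) (λ v → d v * (d v * g v)) + sumFin (n G) (λ v → d v * nbrSum G g v)
    sumEdges-deg-sum-* g = begin
      sumEdges G (λ i j → (d i + d j) * (g i + g j))
        ≡⟨ sumFin-cong (m G) (λ k → expand (d (end₁ G k)) (d (end₂ G k)) (g (end₁ G k)) (g (end₂ G k))) ⟩
      sumEdges G (λ i j → (d i * g i + d j * g j) + (d i * g j + d j * g i))
        ≡⟨ sumFin-+ (m G) _ _ ⟩
      sumEdges G (λ i j → d i * g i + d j * g j) + sumEdges G (λ i j → d i * g j + d j * g i)
        ≡⟨ cong₂ _+_ (sumEdges-endpoints G (λ v → d v * g v)) (sumEdges-symmetrised G d g) ⟩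
      sumFin (n G) (λ v → d v * (d v * g v)) + sumFin (n G) (λ v → d v * nbrSum G g v) ∎
      where expand : ∀ x y u v → (x + y) * (u + v) ≡ (x * u + y * v) + (x * v + y * u)
            expand = solve-∀

    sumEdges-deg-sum² : sumEdges G (λ i j → (d i + d j) ^ 2) ≡ M₁ 3 G + 2 * M₂¹ G
    sumEdges-deg-sum² = begin
      sumEdges G (λ i j → (d i + d j) ^ 2)
        ≡⟨ sumFin-cong (m G) (λ k → m^2≡m*m (d (end₁ G k) + d (end₂ G k))) ⟩
      sumEdges G (λ i j → (d i + d j) * (d i + d j))
        ≡⟨ sumEdges-deg-sum-* d ⟩
      sumFin (n G) (λ v → d v * (d v * d v)) + sumFin (n G) (λ v → d v * S v)
        ≡⟨ cong₂ _+_ (sumFin-cong (n G) (λ v → cong (λ x → d v * (d v * x)) (sym (^-identityʳ (d v))))) sumFin-deg-nbrSum-deg ⟩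
      M₁ 3 G + 2 * M₂¹ G ∎

    sumEdges-deg-sum-deg² : sumEdges G (λ i j → (d i + d j) * (d i ^ 2 + d j ^ 2)) ≡ M₁ 4 G + α₁₂ G
    sumEdges-deg-sum-deg² = begin
      sumEdges G (λ i j → (d i + d j) * (d i ^ 2 + d j ^ 2))
        ≡⟨ sumEdges-deg-sum-* (λ v → d v ^ 2) ⟩
      M₁ 4 G + sumFin (n G) (λ v → d v * nbrSum G (λ w → d w ^ 2) v)
        ≡⟨ cong (M₁ 4 G +_) (trans (nbrSum-self-adjoint G d _) sumFin-deg²-nbrSum-deg) ⟩
      M₁ 4 G + α₁₂ G ∎

    sumEdges-deg-sum³ : sumEdges G (λ i j → (d i + d j) ^ 3) ≡ M₁ 4 G + 3 * α₁₂ G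
    sumEdges-deg-sum³ = begin
      sumEdges G (λ i j → (d i + d j) ^ 3)
        ≡⟨ sumFin-cong (m G) (λ k → cube (d (end₁ G k)) (d (end₂ G k))) ⟩
      sumEdges G (λ i j → (d i + d j) * (d i ^ 2 + d j ^ 2) + 2 * (d i * d j ^ 2 + d i ^ 2 * d j))
        ≡⟨ sumFin-+-*ˡ (m G) _ _ 2 ⟩
      sumEdges G (λ i j → (d i + d j) * (d i ^ 2 + d j ^ 2)) + 2 * sumEdges G (λ i j → d i * d j ^ 2 + d i ^ 2 * d j)
        ≡⟨ cong₂ (λ x y → x + 2 * y) sumEdges-deg-sum-deg² sumEdges-α₁₂ ⟩
      M₁ 4 G + α₁₂ G + 2 * α₁₂ G
        ≡⟨ solve 2 (λ x y → x :+ y :+ con 2 :* y := x :+ con 3 :* y) refl (M₁ 4 G) (α₁₂ G) ⟩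
      M₁ 4 G + 3 * α₁₂ G ∎
      where cube : ∀ x y → (x + y) ^ 3 ≡ (x + y) * (x ^ 2 + y ^ 2) + 2 * (x * y ^ 2 + x ^ 2 * y)
            cube = solve 2 (λ x y → (x :+ y) :^ 3 := (x :+ y) :* (x :^ 2 :+ y :^ 2) :+ con 2 :* (x :* y :^ 2 :+ x :^ 2 :* y)) refl

    sumEdges-deg-sum-ψ : sumEdges G (λ i j → (d i + d j) * (ψ i + ψ j))
                         ≡ M₁ 4 G + 2 * α₁₂ G + (2 * Θ₂ G + M₁ 3 G)
    sumEdges-deg-sum-ψ = begin
      sumEdges G (λ i j → (d i + d j) * (ψ i + ψ j))
        ≡⟨ sumEdges-deg-sum-* ψ ⟩
      sumFin (n G) (λ v → d v * (d v * ψ v)) + sumFin (n G) (λ v → d v * nbrSum G ψ v)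
        ≡⟨ cong₂ _+_ (sumFin-cong (n G) (λ v → distrib (d v) (S v))) (nbrSum-self-adjoint G d ψ) ⟩
      sumFin (n G) (λ v → d v ^ 4 + d v ^ 2 * S v) + sumFin (n G) (λ v → ψ v * S v)
        ≡⟨ cong₂ _+_ (sumFin-+ (n G) _ _) (trans (sumFin-cong (n G) (λ v → *-distribʳ-+ (S v) (d v ^ 2) (S v))) (sumFin-+ (n G) _ _)) ⟩
      M₁ 4 G + sumFin (n G) (λ v → d v ^ 2 * S v) + (sumFin (n G) (λ v → d v ^ 2 * S v) + sumFin (n G) (λ v → S v * S v))
        ≡⟨ cong₂ (λ x y → M₁ 4 G + x + (x + y)) sumFin-deg²-nbrSum-deg sumFin-nbrSum-deg² ⟩
      M₁ 4 G + α₁₂ G + (α₁₂ G + (2 * Θ₂ G + M₁ 3 G))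
        ≡⟨ solve 3 (λ x y z → x :+ y :+ (y :+ z) := x :+ con 2 :* y :+ z) refl (M₁ 4 G) (α₁₂ G) (2 * Θ₂ G + M₁ 3 G) ⟩
      M₁ 4 G + 2 * α₁₂ G + (2 * Θ₂ G + M₁ 3 G) ∎
      where distrib : ∀ x s → x * (x * (x ^ 2 + s)) ≡ x ^ 4 + x ^ 2 * s
            distrib = solve 2 (λ x s → x :* (x :* (x :^ 2 :+ s)) := x :^ 4 :+ x :^ 2 :* s) refl

    sumEdges-ψ : sumEdges G (λ i j → ψ i + ψ j) ≡ M₁ 3 G + 2 * M₂¹ G
    sumEdges-ψ = begin
      sumEdges G (λ i j → ψ i + ψ j)
        ≡⟨ sumEdges-endpoints G ψ ⟩
      sumFin (n G) (λ v → d v * (d v ^ 2 + S v))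
        ≡⟨ trans (sumFin-cong (n G) (λ v → *-distribˡ-+ (d v) (d v ^ 2) (S v))) (sumFin-+ (n G) _ _) ⟩
      M₁ 3 G + sumFin (n G) (λ v → d v * S v)
        ≡⟨ cong (M₁ 3 G +_) sumFin-deg-nbrSum-deg ⟩
      M₁ 3 G + 2 * M₂¹ G ∎

  -- The line graph

  module _ (G : Graph) where
    private
      L = L₁ G
      d = deg G
      a b : Fin (m G) → Fin (n G)
      a = end₁ G
      b = end₂ G
      s : Fin (m G) → ℕ
      s k = d (a k) + d (b k)
      r : Fin (m G) → ℕ
      r k = ψ G (a k) + ψ G (b k)

    nbrSum-L₁ : ∀ k φ → Symmetric G φ →
      nbrSum L (λ l → φ (a l) (b l)) k + 2 * φ (a k) (b k) ≡ nbrSum G (φ (a k)) (a k) + nbrSum G (φ (b k)) (b k)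
    nbrSum-L₁ k φ φ-sym = begin
      nbrSum L g k + 2 * g k           ≡⟨ twice (nbrSum L g k) (g k) ⟩
      nbrSum L g k + g k + g k         ≡⟨ cong (_+ g k) (sumFin-off-diagonal (m G) k _ g (share-refl (a k) (b k))) ⟩
      sumEdges G (λ c e → b2n (share (a k , b k) (c , e)) * φ c e) + g k
                                       ≡⟨ sumEdges-share G φ φ-sym (edge-adj G k) ⟩
      nbrSum G (φ (a k)) (a k) + nbrSum G (φ (b k)) (b k) ∎
      where
      g : Fin (m G) → ℕ
      g l = φ (a l) (b l)
      twice : ∀ x y → x + 2 * y ≡ x + y + y
      twice = solve-∀

    deg-L₁ : ∀ k → deg L k + 2 ≡ d (a k) + d (b k)
    deg-L₁ k = begin
      deg L k + 2                                          ≡⟨ cong (_+ 2) (sym (nbrSum-1 L k)) ⟩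
      nbrSum L (λ _ → 1) k + 2 * 1                         ≡⟨ nbrSum-L₁ k (λ _ _ → 1) (λ _ _ → refl) ⟩
      nbrSum G (λ _ → 1) (a k) + nbrSum G (λ _ → 1) (b k)  ≡⟨ cong₂ _+_ (nbrSum-1 G (a k)) (nbrSum-1 G (b k)) ⟩
      d (a k) + d (b k)                                    ∎

    degE≡deg-L₁ : ∀ k → degE G k ≡ deg L k
    degE≡deg-L₁ k = trans (cong (_∸ 2) (sym (deg-L₁ k))) (m+n∸n≡m (deg L k) 2)

    EM₂≡M₂¹-L₁ : EM₂ G ≡ M₂¹ L
    EM₂≡M₂¹-L₁ = sumFin-cong (m G) (λ k → sumFin-cong (m G) (pointwise k))
      where
      pointwise : ∀ k l → (if (toℕ k <ᵇ toℕ l) ∧ share (edge G k) (edge G l) then degE G k * degE G l else 0)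
                        ≡ (if (toℕ k <ᵇ toℕ l) ∧ adj L k l then deg L k * deg L l else 0)
      pointwise k l with k ≟ l
      ... | yes refl rewrite <ᵇ-false (≤-refl {toℕ k}) = refl
      ... | no _     rewrite degE≡deg-L₁ k | degE≡deg-L₁ l = refl

    nbrSum-L₁-deg : ∀ k → nbrSum L (deg L) k + deg L k * 2 + 2 * s k ≡ r k
    nbrSum-L₁-deg k = begin
      nbrSum L (deg L) k + deg L k * 2 + 2 * s k
        ≡⟨ cong (_+ 2 * s k) (sym (trans (nbrSum-+ L (deg L) (λ _ → 2) k) (cong (nbrSum L (deg L) k +_) (nbrSum-const L 2 k)))) ⟩
      nbrSum L (λ l → deg L l + 2) k + 2 * s k
        ≡⟨ cong (_+ 2 * s k) (nbrSum-cong L deg-L₁ k) ⟩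
      nbrSum L s k + 2 * s k
        ≡⟨ nbrSum-L₁ k (λ u w → d u + d w) (λ u w → +-comm (d u) (d w)) ⟩
      nbrSum G (λ w → d (a k) + d w) (a k) + nbrSum G (λ w → d (b k) + d w) (b k)
        ≡⟨ cong₂ _+_ (nbrSum-deg+deg G (a k)) (nbrSum-deg+deg G (b k)) ⟩
      r k ∎

    M₁²-L₁ : M₁ 2 L + 4 * M₁ 2 G ≡ M₁ 3 G + 2 * M₂¹ G + 4 * m G
    M₁²-L₁ = begin
      M₁ 2 L + 4 * M₁ 2 G
        ≡⟨ cong (λ z → M₁ 2 L + 4 * z) (sym (sumEdges-deg-sum G)) ⟩
      sumFin (m G) (λ k → deg L k ^ 2) + 4 * sumFin (m G) s
        ≡⟨ sym (sumFin-+-*ˡ (m G) _ s 4) ⟩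
      sumFin (m G) (λ k → deg L k ^ 2 + 4 * s k)
        ≡⟨ sumFin-cong (m G) (λ k → shift (deg L k) (s k) (deg-L₁ k)) ⟩
      sumFin (m G) (λ k → s k ^ 2 + 4 * 1)
        ≡⟨ sumFin-+-*ˡ (m G) _ _ 4 ⟩
      sumFin (m G) (λ k → s k ^ 2) + 4 * sumFin (m G) (λ _ → 1)
        ≡⟨ cong₂ (λ x y → x + 4 * y) (sumEdges-deg-sum² G) (sumFin-1 (m G)) ⟩
      M₁ 3 G + 2 * M₂¹ G + 4 * m G ∎
      where
      shift : ∀ x y → x + 2 ≡ y → x ^ 2 + 4 * y ≡ y ^ 2 + 4 * 1
      shift x .(x + 2) refl = solve 1 (λ x → x :^ 2 :+ con 4 :* (x :+ con 2) := (x :+ con 2) :^ 2 :+ con 4 :* con 1) refl x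

    M₁³-L₁ : M₁ 3 L + 6 * M₁ 3 G + 12 * M₂¹ G + 8 * m G ≡ M₁ 4 G + 3 * α₁₂ G + 12 * M₁ 2 G
    M₁³-L₁ = begin
      M₁ 3 L + 6 * M₁ 3 G + 12 * M₂¹ G + 8 * m G
        ≡⟨ solve 4 (λ x y z w → x :+ con 6 :* y :+ con 12 :* z :+ con 8 :* w := x :+ con 6 :* (y :+ con 2 :* z) :+ con 8 :* w)
                   refl (M₁ 3 L) (M₁ 3 G) (M₂¹ G) (m G) ⟩
      M₁ 3 L + 6 * (M₁ 3 G + 2 * M₂¹ G) + 8 * m G
        ≡⟨ cong₂ (λ x y → M₁ 3 L + 6 * x + 8 * y) (sym (sumEdges-deg-sum² G)) (sym (sumFin-1 (m G))) ⟩
      sumFin (m G) (λ k → deg L k ^ 3) + 6 * sumFin (m G) (λ k → s k ^ 2) + 8 * sumFin (m G) (λ _ → 1)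
        ≡⟨ sym (trans (sumFin-+-*ˡ (m G) _ _ 8) (cong (_+ 8 * sumFin (m G) (λ _ → 1)) (sumFin-+-*ˡ (m G) _ _ 6))) ⟩
      sumFin (m G) (λ k → deg L k ^ 3 + 6 * s k ^ 2 + 8 * 1)
        ≡⟨ sumFin-cong (m G) (λ k → shift (deg L k) (s k) (deg-L₁ k)) ⟩
      sumFin (m G) (λ k → s k ^ 3 + 12 * s k)
        ≡⟨ sumFin-+-*ˡ (m G) _ _ 12 ⟩
      sumFin (m G) (λ k → s k ^ 3) + 12 * sumFin (m G) s
        ≡⟨ cong₂ (λ x y → x + 12 * y) (sumEdges-deg-sum³ G) (sumEdges-deg-sum G) ⟩
      M₁ 4 G + 3 * α₁₂ G + 12 * M₁ 2 G ∎
      where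
      shift : ∀ x y → x + 2 ≡ y → x ^ 3 + 6 * y ^ 2 + 8 * 1 ≡ y ^ 3 + 12 * y
      shift x .(x + 2) refl =
        solve 1 (λ x → x :^ 3 :+ con 6 :* (x :+ con 2) :^ 2 :+ con 8 :* con 1 := (x :+ con 2) :^ 3 :+ con 12 :* (x :+ con 2)) refl x

    sumFin-deg-nbrSum-deg-L₁ :
      sumFin (m G) (λ k → deg L k * nbrSum L (deg L) k) + 4 * sumFin (m G) (λ k → s k ^ 2)
        + 2 * sumFin (m G) r + 8 * sumFin (m G) (λ _ → 1)
      ≡ sumFin (m G) (λ k → s k * r k) + 12 * sumFin (m G) s
    sumFin-deg-nbrSum-deg-L₁ = begin
      sumFin (m G) (λ k → deg L k * nbrSum L (deg L) k) + 4 * sumFin (m G) (λ k → s k ^ 2)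
        + 2 * sumFin (m G) r + 8 * sumFin (m G) (λ _ → 1)
        ≡⟨ sym (trans (sumFin-+-*ˡ (m G) _ _ 8) (cong (_+ 8 * sumFin (m G) (λ _ → 1))
             (trans (sumFin-+-*ˡ (m G) _ _ 2) (cong (_+ 2 * sumFin (m G) r) (sumFin-+-*ˡ (m G) _ _ 4))))) ⟩
      sumFin (m G) (λ k → deg L k * nbrSum L (deg L) k + 4 * s k ^ 2 + 2 * r k + 8 * 1)
        ≡⟨ sumFin-cong (m G) (λ k → per-edge (deg L k) (s k) _ _ (deg-L₁ k) (nbrSum-L₁-deg k)) ⟩
      sumFin (m G) (λ k → s k * r k + 12 * s k)
        ≡⟨ sumFin-+-*ˡ (m G) _ _ 12 ⟩
      sumFin (m G) (λ k → s k * r k) + 12 * sumFin (m G) s ∎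
      where
      -- for the edge k = uv: x = deg_{L₁} k, y = d u + d v, t = Σ_{l ∼ k} deg_{L₁} l, z = ψ u + ψ v
      per-edge : ∀ x y t z → x + 2 ≡ y → t + x * 2 + 2 * y ≡ z → x * t + 4 * y ^ 2 + 2 * z + 8 * 1 ≡ y * z + 12 * y
      per-edge x .(x + 2) t .(t + x * 2 + 2 * (x + 2)) refl refl =
        solve 2 (λ x t → x :* t :+ con 4 :* (x :+ con 2) :^ 2 :+ con 2 :* (t :+ x :* con 2 :+ con 2 :* (x :+ con 2)) :+ con 8 :* con 1
                        := (x :+ con 2) :* (t :+ x :* con 2 :+ con 2 :* (x :+ con 2)) :+ con 12 :* (x :+ con 2)) refl x t

    EM₂-Θ₂ : 2 * EM₂ G + 5 * M₁ 3 G + 12 * M₂¹ G + 8 * m G ≡ M₁ 4 G + 2 * Θ₂ G + 2 * α₁₂ G + 12 * M₁ 2 G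
    EM₂-Θ₂ = +-cancelʳ-≡ (M₁ 3 G) _ _ (begin
      2 * EM₂ G + 5 * M₁ 3 G + 12 * M₂¹ G + 8 * m G + M₁ 3 G
        ≡⟨ solve 4 (λ e x y z → con 2 :* e :+ con 5 :* x :+ con 12 :* y :+ con 8 :* z :+ x
                             := con 2 :* e :+ con 4 :* (x :+ con 2 :* y) :+ con 2 :* (x :+ con 2 :* y) :+ con 8 :* z)
                   refl (EM₂ G) (M₁ 3 G) (M₂¹ G) (m G) ⟩
      2 * EM₂ G + 4 * (M₁ 3 G + 2 * M₂¹ G) + 2 * (M₁ 3 G + 2 * M₂¹ G) + 8 * m G
        ≡⟨ cong₂ (λ u v → u + 4 * v + 2 * (M₁ 3 G + 2 * M₂¹ G) + 8 * m G)
             (trans (cong (2 *_) EM₂≡M₂¹-L₁) (sym (sumFin-deg-nbrSum-deg L))) (sym (sumEdges-deg-sum² G)) ⟩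
      sumFin (m G) (λ k → deg L k * nbrSum L (deg L) k) + 4 * sumFin (m G) (λ k → s k ^ 2)
        + 2 * (M₁ 3 G + 2 * M₂¹ G) + 8 * m G
        ≡⟨ cong₂ (λ u v → sumFin (m G) (λ k → deg L k * nbrSum L (deg L) k) + 4 * sumFin (m G) (λ k → s k ^ 2) + 2 * u + 8 * v)
             (sym (sumEdges-ψ G)) (sym (sumFin-1 (m G))) ⟩
      sumFin (m G) (λ k → deg L k * nbrSum L (deg L) k) + 4 * sumFin (m G) (λ k → s k ^ 2)
        + 2 * sumFin (m G) r + 8 * sumFin (m G) (λ _ → 1)
        ≡⟨ sumFin-deg-nbrSum-deg-L₁ ⟩
      sumFin (m G) (λ k → s k * r k) + 12 * sumFin (m G) s
        ≡⟨ cong₂ (λ u v → u + 12 * v) (sumEdges-deg-sum-ψ G) (sumEdges-deg-sum G) ⟩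
      M₁ 4 G + 2 * α₁₂ G + (2 * Θ₂ G + M₁ 3 G) + 12 * M₁ 2 G
        ≡⟨ solve 5 (λ f a t x w → f :+ con 2 :* a :+ (con 2 :* t :+ x) :+ con 12 :* w
                               := f :+ con 2 :* t :+ con 2 :* a :+ con 12 :* w :+ x)
                   refl (M₁ 4 G) (α₁₂ G) (Θ₂ G) (M₁ 3 G) (M₁ 2 G) ⟩
      M₁ 4 G + 2 * Θ₂ G + 2 * α₁₂ G + 12 * M₁ 2 G + M₁ 3 G ∎)

  M₁²-L₂ : (G : Graph) → M₁ 2 (L₂ G) + 4 * M₁ 2 (L₁ G) ≡ M₁ 3 (L₁ G) + 2 * EM₂ G + 4 * m (L₁ G)
  M₁²-L₂ G = trans (M₁²-L₁ (L₁ G)) (cong (λ z → M₁ 3 (L₁ G) + 2 * z + 4 * m (L₁ G)) (sym (EM₂≡M₂¹-L₁ G)))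

-- Passing to ℚ

open DegreeSums using (M₁²-L₁; M₁²-L₂; M₁³-L₁; EM₂-Θ₂)

open import Data.Product using (_,_)
open import Data.Rational using (ℚ; mkℚ; _+_; _-_; _*_; _/_)
open import Data.Rational.Properties using (normalize-coprime)
open import Data.Rational.Solver using (module +-*-Solver)
open import Data.Integer using (+_)
open import Data.Integer.Properties using (+◃n≡+n; pos-*)
import Data.Nat as ℕ
open import Data.Nat.Properties using (*-identityʳ)
open import Data.Nat.Coprimality using (1-coprimeTo)
import Data.Nat.Coprimality as Coprime
open import Relation.Binary.PropositionalEquality using (refl; sym; trans; cong; cong₂; module ≡-Reasoning)
open +-*-Solver using (solve; _:+_; _:-_; _:*_; con; _:=_)
open ≡-Reasoning

toℚ : ℕ → ℚ
toℚ k = + k / 1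

toℚ≡mkℚ : ∀ k → toℚ k ≡ mkℚ (+ k) 0 (Coprime.sym (1-coprimeTo k))
toℚ≡mkℚ k = normalize-coprime (Coprime.sym (1-coprimeTo k))

-- Once both summands are in the normal form mkℚ (+ k) 0 _, the sum computes.
toℚ-+ : ∀ a b → toℚ (a ℕ.+ b) ≡ toℚ a + toℚ b
toℚ-+ a b rewrite toℚ≡mkℚ a | toℚ≡mkℚ b | *-identityʳ a | *-identityʳ b | +◃n≡+n a | +◃n≡+n b = refl

toℚ-* : ∀ a b → toℚ (a ℕ.* b) ≡ toℚ a * toℚ b
toℚ-* a b = trans (cong (_/ 1) (pos-* a b)) (sym (cong₂ _*_ (toℚ≡mkℚ a) (toℚ≡mkℚ b)))

toℚ-+-* : ∀ a k b → toℚ (a ℕ.+ k ℕ.* b) ≡ toℚ a + toℚ k * toℚ b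
toℚ-+-* a k b = trans (toℚ-+ a (k ℕ.* b)) (cong (λ z → toℚ a + z) (toℚ-* k b))

toℚ-+-*-+-* : ∀ a k b l c → toℚ (a ℕ.+ k ℕ.* b ℕ.+ l ℕ.* c) ≡ toℚ a + toℚ k * toℚ b + toℚ l * toℚ c
toℚ-+-*-+-* a k b l c = trans (toℚ-+-* (a ℕ.+ k ℕ.* b) l c) (cong (_+ toℚ l * toℚ c) (toℚ-+-* a k b))

toℚ-+-*-+-*-+-* : ∀ a k b l c j e →
  toℚ (a ℕ.+ k ℕ.* b ℕ.+ l ℕ.* c ℕ.+ j ℕ.* e) ≡ toℚ a + toℚ k * toℚ b + toℚ l * toℚ c + toℚ j * toℚ e
toℚ-+-*-+-*-+-* a k b l c j e = trans (toℚ-+-* (a ℕ.+ k ℕ.* b ℕ.+ l ℕ.* c) j e) (cong (_+ toℚ j * toℚ e) (toℚ-+-*-+-* a k b l c))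

solve-for : ∀ (x r p q c : ℚ) → r ≡ x + c * (p - q) → p ≡ q → x ≡ r
solve-for x r p q c r≡x+c[p-q] p≡q = sym (begin
  r                  ≡⟨ r≡x+c[p-q] ⟩
  x + c * (p - q)    ≡⟨ cong (λ z → x + c * (z - q)) p≡q ⟩
  x + c * (q - q)    ≡⟨ solve 3 (λ x q c → x :+ c :* (q :- q) := x) refl x q c ⟩
  x                  ∎)

M₂-from-M₁²-L₁ : ∀ M₂ M₁²L M₁³ M₁² mG → M₁²L ℕ.+ 4 ℕ.* M₁² ≡ M₁³ ℕ.+ 2 ℕ.* M₂ ℕ.+ 4 ℕ.* mG →
  toℚ M₂ ≡ (+ 1 / 2) * toℚ M₁²L - (+ 1 / 2) * toℚ M₁³ + (+ 2 / 1) * toℚ M₁² - (+ 2 / 1) * toℚ mG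
M₂-from-M₁²-L₁ M₂ M₁²L M₁³ M₁² mG eq = solve-for _ _ _ _ (+ 1 / 2)
  (solve 5 (λ M₂ M₁²L M₁³ M₁² mG →
      con (+ 1 / 2) :* M₁²L :- con (+ 1 / 2) :* M₁³ :+ con (+ 2 / 1) :* M₁² :- con (+ 2 / 1) :* mG
      := M₂ :+ con (+ 1 / 2) :* ((M₁²L :+ con (+ 4 / 1) :* M₁²) :- (M₁³ :+ con (+ 2 / 1) :* M₂ :+ con (+ 4 / 1) :* mG)))
    refl (toℚ M₂) (toℚ M₁²L) (toℚ M₁³) (toℚ M₁²) (toℚ mG))
  (begin
    toℚ M₁²L + toℚ 4 * toℚ M₁²                ≡⟨ sym (toℚ-+-* M₁²L 4 M₁²) ⟩
    toℚ (M₁²L ℕ.+ 4 ℕ.* M₁²)                  ≡⟨ cong toℚ eq ⟩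
    toℚ (M₁³ ℕ.+ 2 ℕ.* M₂ ℕ.+ 4 ℕ.* mG)       ≡⟨ toℚ-+-*-+-* M₁³ 2 M₂ 4 mG ⟩
    toℚ M₁³ + toℚ 2 * toℚ M₂ + toℚ 4 * toℚ mG ∎)

α-from-M₁³-L₁ : ∀ α M₁³L M₁⁴ M₁³ M₂ M₁² mG → M₁³L ℕ.+ 6 ℕ.* M₁³ ℕ.+ 12 ℕ.* M₂ ℕ.+ 8 ℕ.* mG ≡ M₁⁴ ℕ.+ 3 ℕ.* α ℕ.+ 12 ℕ.* M₁² →
  toℚ α ≡ (+ 1 / 3) * toℚ M₁³L - (+ 1 / 3) * toℚ M₁⁴ + (+ 2 / 1) * toℚ M₁³ + (+ 4 / 1) * toℚ M₂
          - (+ 4 / 1) * toℚ M₁² + (+ 8 / 3) * toℚ mG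
α-from-M₁³-L₁ α M₁³L M₁⁴ M₁³ M₂ M₁² mG eq = solve-for _ _ _ _ (+ 1 / 3)
  (solve 7 (λ α M₁³L M₁⁴ M₁³ M₂ M₁² mG →
      con (+ 1 / 3) :* M₁³L :- con (+ 1 / 3) :* M₁⁴ :+ con (+ 2 / 1) :* M₁³ :+ con (+ 4 / 1) :* M₂
        :- con (+ 4 / 1) :* M₁² :+ con (+ 8 / 3) :* mG
      := α :+ con (+ 1 / 3) :* ((M₁³L :+ con (+ 6 / 1) :* M₁³ :+ con (+ 12 / 1) :* M₂ :+ con (+ 8 / 1) :* mG)
                               :- (M₁⁴ :+ con (+ 3 / 1) :* α :+ con (+ 12 / 1) :* M₁²)))
    refl (toℚ α) (toℚ M₁³L) (toℚ M₁⁴) (toℚ M₁³) (toℚ M₂) (toℚ M₁²) (toℚ mG))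
  (begin
    toℚ M₁³L + toℚ 6 * toℚ M₁³ + toℚ 12 * toℚ M₂ + toℚ 8 * toℚ mG  ≡⟨ sym (toℚ-+-*-+-*-+-* M₁³L 6 M₁³ 12 M₂ 8 mG) ⟩
    toℚ (M₁³L ℕ.+ 6 ℕ.* M₁³ ℕ.+ 12 ℕ.* M₂ ℕ.+ 8 ℕ.* mG)           ≡⟨ cong toℚ eq ⟩
    toℚ (M₁⁴ ℕ.+ 3 ℕ.* α ℕ.+ 12 ℕ.* M₁²)                         ≡⟨ toℚ-+-*-+-* M₁⁴ 3 α 12 M₁² ⟩
    toℚ M₁⁴ + toℚ 3 * toℚ α + toℚ 12 * toℚ M₁²                   ∎)

Θ-from-EM₂-Θ₂ : ∀ Θ E α M₁⁴ M₁³ M₂ M₁² mG →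
  2 ℕ.* E ℕ.+ 5 ℕ.* M₁³ ℕ.+ 12 ℕ.* M₂ ℕ.+ 8 ℕ.* mG ≡ M₁⁴ ℕ.+ 2 ℕ.* Θ ℕ.+ 2 ℕ.* α ℕ.+ 12 ℕ.* M₁² →
  toℚ Θ ≡ toℚ E - toℚ α - (+ 1 / 2) * toℚ M₁⁴ + (+ 5 / 2) * toℚ M₁³ + (+ 6 / 1) * toℚ M₂
          - (+ 6 / 1) * toℚ M₁² + (+ 4 / 1) * toℚ mG
Θ-from-EM₂-Θ₂ Θ E α M₁⁴ M₁³ M₂ M₁² mG eq = solve-for _ _ _ _ (+ 1 / 2)
  (solve 8 (λ Θ E α M₁⁴ M₁³ M₂ M₁² mG →
      E :- α :- con (+ 1 / 2) :* M₁⁴ :+ con (+ 5 / 2) :* M₁³ :+ con (+ 6 / 1) :* M₂ :- con (+ 6 / 1) :* M₁² :+ con (+ 4 / 1) :* mG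
      := Θ :+ con (+ 1 / 2) :* ((con (+ 2 / 1) :* E :+ con (+ 5 / 1) :* M₁³ :+ con (+ 12 / 1) :* M₂ :+ con (+ 8 / 1) :* mG)
                               :- (M₁⁴ :+ con (+ 2 / 1) :* Θ :+ con (+ 2 / 1) :* α :+ con (+ 12 / 1) :* M₁²)))
    refl (toℚ Θ) (toℚ E) (toℚ α) (toℚ M₁⁴) (toℚ M₁³) (toℚ M₂) (toℚ M₁²) (toℚ mG))
  (begin
    toℚ 2 * toℚ E + toℚ 5 * toℚ M₁³ + toℚ 12 * toℚ M₂ + toℚ 8 * toℚ mG
      ≡⟨ cong (λ z → z + toℚ 5 * toℚ M₁³ + toℚ 12 * toℚ M₂ + toℚ 8 * toℚ mG) (sym (toℚ-* 2 E)) ⟩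
    toℚ (2 ℕ.* E) + toℚ 5 * toℚ M₁³ + toℚ 12 * toℚ M₂ + toℚ 8 * toℚ mG
      ≡⟨ sym (toℚ-+-*-+-*-+-* (2 ℕ.* E) 5 M₁³ 12 M₂ 8 mG) ⟩
    toℚ (2 ℕ.* E ℕ.+ 5 ℕ.* M₁³ ℕ.+ 12 ℕ.* M₂ ℕ.+ 8 ℕ.* mG)
      ≡⟨ cong toℚ eq ⟩
    toℚ (M₁⁴ ℕ.+ 2 ℕ.* Θ ℕ.+ 2 ℕ.* α ℕ.+ 12 ℕ.* M₁²)
      ≡⟨ toℚ-+-*-+-*-+-* M₁⁴ 2 Θ 2 α 12 M₁² ⟩
    toℚ M₁⁴ + toℚ 2 * toℚ Θ + toℚ 2 * toℚ α + toℚ 12 * toℚ M₁²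
      ∎)

Θ₂-formula : (G : Graph) → toℚ (Θ₂ G) ≡ (+ 1 / 2) * toℚ (M₁ 2 (L₂ G)) - (+ 5 / 6) * toℚ (M₁ 3 (L₁ G))
                                         + (+ 2 / 1) * toℚ (M₁ 2 (L₁ G)) - (+ 2 / 1) * toℚ (m (L₁ G))
                                         - (+ 1 / 6) * toℚ (M₁ 4 G) + (+ 1 / 2) * toℚ (M₁ 3 G)
                                         + (+ 2 / 1) * toℚ (M₂¹ G) - (+ 2 / 1) * toℚ (M₁ 2 G)
                                         + (+ 4 / 3) * toℚ (m G)
Θ₂-formula G = begin
  toℚ (Θ₂ G)
    ≡⟨ Θ-from-EM₂-Θ₂ (Θ₂ G) (EM₂ G) (α₁₂ G) (M₁ 4 G) (M₁ 3 G) (M₂¹ G) (M₁ 2 G) (m G) (EM₂-Θ₂ G) ⟩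
  toℚ (EM₂ G) - toℚ (α₁₂ G) - (+ 1 / 2) * M₁⁴ + (+ 5 / 2) * M₁³ + (+ 6 / 1) * M₂ - (+ 6 / 1) * M₁² + (+ 4 / 1) * mG
    ≡⟨ cong₂ (λ E α → E - α - (+ 1 / 2) * M₁⁴ + (+ 5 / 2) * M₁³ + (+ 6 / 1) * M₂ - (+ 6 / 1) * M₁² + (+ 4 / 1) * mG)
             (M₂-from-M₁²-L₁ (EM₂ G) (M₁ 2 (L₂ G)) (M₁ 3 (L₁ G)) (M₁ 2 (L₁ G)) (m (L₁ G)) (M₁²-L₂ G))
             (α-from-M₁³-L₁ (α₁₂ G) (M₁ 3 (L₁ G)) (M₁ 4 G) (M₁ 3 G) (M₂¹ G) (M₁ 2 G) (m G) (M₁³-L₁ G)) ⟩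
  ((+ 1 / 2) * M₁²L₂ - (+ 1 / 2) * M₁³L + (+ 2 / 1) * M₁²L - (+ 2 / 1) * mL)
    - ((+ 1 / 3) * M₁³L - (+ 1 / 3) * M₁⁴ + (+ 2 / 1) * M₁³ + (+ 4 / 1) * M₂ - (+ 4 / 1) * M₁² + (+ 8 / 3) * mG)
    - (+ 1 / 2) * M₁⁴ + (+ 5 / 2) * M₁³ + (+ 6 / 1) * M₂ - (+ 6 / 1) * M₁² + (+ 4 / 1) * mG
    ≡⟨ solve 9 (λ M₁²L₂ M₁³L M₁²L mL M₁⁴ M₁³ M₂ M₁² mG →
         (con (+ 1 / 2) :* M₁²L₂ :- con (+ 1 / 2) :* M₁³L :+ con (+ 2 / 1) :* M₁²L :- con (+ 2 / 1) :* mL)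
         :- (con (+ 1 / 3) :* M₁³L :- con (+ 1 / 3) :* M₁⁴ :+ con (+ 2 / 1) :* M₁³ :+ con (+ 4 / 1) :* M₂
             :- con (+ 4 / 1) :* M₁² :+ con (+ 8 / 3) :* mG)
         :- con (+ 1 / 2) :* M₁⁴ :+ con (+ 5 / 2) :* M₁³ :+ con (+ 6 / 1) :* M₂ :- con (+ 6 / 1) :* M₁² :+ con (+ 4 / 1) :* mG
         := con (+ 1 / 2) :* M₁²L₂ :- con (+ 5 / 6) :* M₁³L :+ con (+ 2 / 1) :* M₁²L :- con (+ 2 / 1) :* mL
            :- con (+ 1 / 6) :* M₁⁴ :+ con (+ 1 / 2) :* M₁³ :+ con (+ 2 / 1) :* M₂ :- con (+ 2 / 1) :* M₁² :+ con (+ 4 / 3) :* mG)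
         refl M₁²L₂ M₁³L M₁²L mL M₁⁴ M₁³ M₂ M₁² mG ⟩
  (+ 1 / 2) * M₁²L₂ - (+ 5 / 6) * M₁³L + (+ 2 / 1) * M₁²L - (+ 2 / 1) * mL
    - (+ 1 / 6) * M₁⁴ + (+ 1 / 2) * M₁³ + (+ 2 / 1) * M₂ - (+ 2 / 1) * M₁² + (+ 4 / 3) * mG ∎
  where
  M₁²L₂ M₁³L M₁²L mL M₁⁴ M₁³ M₂ M₁² mG : ℚ
  M₁²L₂ = toℚ (M₁ 2 (L₂ G))
  M₁³L  = toℚ (M₁ 3 (L₁ G))
  M₁²L  = toℚ (M₁ 2 (L₁ G))
  mL    = toℚ (m (L₁ G))
  M₁⁴   = toℚ (M₁ 4 G)
  M₁³   = toℚ (M₁ 3 G)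
  M₂    = toℚ (M₂¹ G)
  M₁²   = toℚ (M₁ 2 G)
  mG    = toℚ (m G)

lemma3p4 : (G : Graph) →
    let q : ℕ → ℚ
        q k = + k / 1
    in (q (M₂¹ G) ≡ (+ 1 / 2) * q (M₁ 2 (L₁ G)) - (+ 1 / 2) * q (M₁ 3 G)
                      + (+ 2 / 1) * q (M₁ 2 G) - (+ 2 / 1) * q (m G))
     × (q (EM₂ G) ≡ (+ 1 / 2) * q (M₁ 2 (L₂ G)) - (+ 1 / 2) * q (M₁ 3 (L₁ G))
                      + (+ 2 / 1) * q (M₁ 2 (L₁ G)) - (+ 2 / 1) * q (m (L₁ G)))
     × (q (α₁₂ G) ≡ (+ 1 / 3) * q (M₁ 3 (L₁ G)) - (+ 1 / 3) * q (M₁ 4 G)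
                      + (+ 2 / 1) * q (M₁ 3 G) + (+ 4 / 1) * q (M₂¹ G)
                      - (+ 4 / 1) * q (M₁ 2 G) + (+ 8 / 3) * q (m G))
     × (q (Θ₂ G) ≡ (+ 1 / 2) * q (M₁ 2 (L₂ G)) - (+ 5 / 6) * q (M₁ 3 (L₁ G))
                      + (+ 2 / 1) * q (M₁ 2 (L₁ G)) - (+ 2 / 1) * q (m (L₁ G))
                      - (+ 1 / 6) * q (M₁ 4 G) + (+ 1 / 2) * q (M₁ 3 G)
                      + (+ 2 / 1) * q (M₂¹ G) - (+ 2 / 1) * q (M₁ 2 G)
                      + (+ 4 / 3) * q (m G))
lemma3p4 G =
    M₂-from-M₁²-L₁ (M₂¹ G) (M₁ 2 (L₁ G)) (M₁ 3 G) (M₁ 2 G) (m G) (M₁²-L₁ G)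
  , M₂-from-M₁²-L₁ (EM₂ G) (M₁ 2 (L₂ G)) (M₁ 3 (L₁ G)) (M₁ 2 (L₁ G)) (m (L₁ G)) (M₁²-L₂ G)
  , α-from-M₁³-L₁ (α₁₂ G) (M₁ 3 (L₁ G)) (M₁ 4 G) (M₁ 3 G) (M₂¹ G) (M₁ 2 G) (m G) (M₁³-L₁ G)
  , Θ₂-formula G
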